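{- For every $n\ge0$, the map $SSA$ sending a word $w\in A^*$ of length $n$ to the pair $(\mathrm{bst}(w),\ \mathcal{T}(\mathrm{std}(w)^{ -1}))$ is a bijection between the set of words of length $n$ over $A$ and the set of pairs $(t_1,t_2)$ where $t_1$ is a binary search tree with $n$ nodes labeled by letters of $A$ and $t_2$ is a standard decreasing tree having the same shape as $t_1$. Its inverse is the map $SSB$ which sends such a pair $(t_1,t_2)$ to the word obtained by reading the labels of $t_1$ in the order given by the corresponding labels of $t_2$, i.e. the $i$-th letter of $SSB(t_1,t_2)$ is the label of $t_1$ at the node where $t_2$ has label $i$.
   Context: $A$ is a totally ordered infinite alphabet, identified with $\{1<2<\cdots\}$ for permutations. For a word $w$ of length $n$, $\mathrm{std}(w)\in S_n$ is obtained by scanning $w$ from left to right and labelling $1,2,\dots$ the occurrences of its smallest letter, then continuing with the occurrences of the next smallest letter, and so on. A binary tree is either empty or a node with left and right (possibly empty) subtrees; its shape is the underlying unlabeled tree. A binary search tree is a binary tree with nodes labeled in $A$ such that each node's label is $\ge$ all labels of its left subtree and $<$ all labels of its right subtree. $\mathrm{bst}(w)$ is obtained by reading $w$ from right to left and inserting each letter $x$: into an empty tree create a node labeled $x$; otherwise insert recursively into the left subtree if $x\le$ root label, into the right subtree if $x>$ root label. A decreasing tree is a labeled tree in which each node's label is greater than the labels of its children; it is standard if its labels are exactly $1,\dots,n$ where $n$ is the number of nodes. For a word $w$ without repeated letters, $\mathcal{T}(w)$ is empty if $w$ is empty, and otherwise has root labeled by the greatest letter $m$ of $w$ and, writing $w=u\,m\,v$,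 left subtree $\mathcal{T}(u)$ and right subtree $\mathcal{T}(v)$. -}

module Defs where

open import Data.Nat using (ℕ; zero; suc; _+_; _<_; _≤_; _⊔_; _<?_; _≟_)
open import Data.List using (List; []; _∷_; _++_; length; filter; foldr; map; span; zip)
open import Data.Product using (_×_; _,_; proj₁; proj₂)
open import Data.Unit using (⊤)
open import Data.Empty using (⊥)
open import Relation.Nullary using (¬?; yes; no)
open import Data.List.Relation.Binary.Permutation.Propositional using (_↭_)

-- The alphabet A is ℕ with its usual order (an infinite total order).
Word : Set
Word = List ℕ

data Tree (X : Set) : Set where
  leaf : Tree X
  node : Tree X → X → Tree X → Tree X

size : {X : Set} → Tree X → ℕ
size leaf = 0
size (node l _ r) = suc (size l + size r)


data SameShape {X Y : Set} : Tree X → Tree Y → Set where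
  leaf : SameShape leaf leaf
  node : ∀ {l₁ r₁ l₂ r₂ x y} → SameShape l₁ l₂ → SameShape r₁ r₂ →
         SameShape (node l₁ x r₁) (node l₂ y r₂)

AllT : {X : Set} → (X → Set) → Tree X → Set
AllT P leaf = ⊤
AllT P (node l x r) = AllT P l × P x × AllT P r

IsBST : Tree ℕ → Set
IsBST leaf = ⊤
IsBST (node l x r) = IsBST l × AllT (λ y → y ≤ x) l × AllT (λ y → x < y) r × IsBST r

RootBelow : ℕ → Tree ℕ → Set
RootBelow x leaf = ⊤
RootBelow x (node _ y _) = y < x

IsDecreasing : Tree ℕ → Set
IsDecreasing leaf = ⊤
IsDecreasing (node l x r) = IsDecreasing l × RootBelow x l × RootBelow x r × IsDecreasing r

labels : {X : Set} → Tree X → List X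
labels leaf = []
labels (node l x r) = labels l ++ (x ∷ labels r)

oneTo : ℕ → List ℕ
oneTo zero = []
oneTo (suc n) = oneTo n ++ (suc n ∷ [])

IsStdDecreasing : Tree ℕ → Set
IsStdDecreasing t = IsDecreasing t × (labels t ↭ oneTo (size t))

insert : ℕ → Tree ℕ → Tree ℕ
insert x leaf = node leaf x leaf
insert x (node l y r) with y <? x
... | yes _ = node l y (insert x r)
... | no  _ = node (insert x l) y r

bst : Word → Tree ℕ
bst w = foldr insert leaf w

-- standardization std(w) ∈ S_n as a word over 1..n:
-- the letter at position i is 1 + #{j : w_j < w_i} + #{j < i : w_j = w_i}
countLt : ℕ → Word → ℕ
countLt x w = length (filter (λ y → y <? x) w)

countEq : ℕ → Word → ℕ
countEq x w = length (filter (λ y → y ≟ x) w)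

stdAux : Word → Word → Word → Word
stdAux w pre [] = []
stdAux w pre (x ∷ xs) = suc (countLt x w + countEq x pre) ∷ stdAux w (pre ++ (x ∷ [])) xs

std : Word → Word
std w = stdAux w [] w

-- 1-based position of the first occurrence of k in a word (0 if absent)
positionOf : ℕ → Word → ℕ
positionOf k [] = 0
positionOf k (x ∷ xs) with x ≟ k
... | yes _ = 1
... | no  _ = suc (positionOf k xs)

inverse : Word → Word
inverse p = map (λ k → positionOf k p) (oneTo (length p))

-- 𝒯(w) for words without repeated letters: root = greatest letter m,
-- w = u m v, left subtree 𝒯(u), right subtree 𝒯(v).
-- Defined with fuel; fuel = length w suffices (both u and v are shorter than w).
maxOf : ℕ → Word → ℕ
maxOf x xs = foldr _⊔_ x xs

𝒯-fuel : ℕ → Word → Tree ℕ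
𝒯-fuel zero w = leaf
𝒯-fuel (suc k) [] = leaf
𝒯-fuel (suc k) (x ∷ xs) =
  let m  = maxOf x xs
      uv = span (λ y → ¬? (y ≟ m)) (x ∷ xs)
  in node (𝒯-fuel k (proj₁ uv)) m (𝒯-fuel k (drop1 (proj₂ uv)))
  where
  drop1 : Word → Word
  drop1 [] = []
  drop1 (_ ∷ ys) = ys

𝒯 : Word → Tree ℕ
𝒯 w = 𝒯-fuel (length w) w

SSA : Word → Tree ℕ × Tree ℕ
SSA w = bst w , 𝒯 (inverse (std w))

-- label of t₁ at the node where t₂ has label i; nodes are matched through the
-- common shape, i.e. via in-order position (0 if no such node, which does not
-- happen on the domain of SSB)
lookupLabel : ℕ → List (ℕ × ℕ) → ℕ
lookupLabel i [] = 0
lookupLabel i ((a , b) ∷ ps) with b ≟ i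
... | yes _ = a
... | no  _ = lookupLabel i ps

SSB : Tree ℕ → Tree ℕ → Word
SSB t₁ t₂ = map (λ i → lookupLabel i (zip (labels t₁) (labels t₂))) (oneTo (size t₂))

{-# OPTIONS --safe #-}

-- Pair every letter of w with its position and insert the pairs (wᵢ , i), from right to left, into a
-- binary search tree ordered by letters. The result is a treap: a search tree in the letters and a
-- decreasing tree in the positions, so its letters form bst(w). Its in-order list of pairs is sorted
-- lexicographically, and std(w) numbers the positions in exactly this order; so the positions, read in
-- order, form std(w)⁻¹, and since 𝒯 rebuilds a decreasing tree from its in-order reading, they form
-- 𝒯(std(w)⁻¹). Conversely, a search tree and a standard decreasing tree of the same shape zip to a
-- treap whose pairs are those of SSB(t₁, t₂). A treap is determined by its set of pairs: its root is the
-- pair with the greatest position, and the root letter splits the remaining pairs between the subtrees.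
-- Hence SSA(SSB(t₁, t₂)) = (t₁, t₂).

module Submission where

open import Defs
open import Data.Nat using (ℕ; zero; suc; _+_; _≤_; _<_; s≤s; z<s; s<s)
open import Data.Nat.Properties
open import Data.Fin using (toℕ)
open import Data.List
  using (List; []; _∷_; _++_; _∷ʳ_; [_]; length; map; filter; foldr; span; zip; applyUpTo; upTo)
open import Data.List.Properties
  using (map-++; map-∘; map-cong; map-cong-local; map-id-local; length-map; length-++; ++-assoc; ++-identityʳ;
         length-applyUpTo; applyUpTo-∷ʳ; map-upTo; foldr-preservesᵇ; foldr-preservesᵒ;
         filter-++; filter-all; filter-none; filter-accept; filter-reject)
open import Data.List.Relation.Unary.All as All using (All; []; _∷_)
import Data.List.Relation.Unary.All.Properties as All
open import Data.List.Relation.Unary.Any as Any using (here; there; index)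
open import Data.List.Relation.Unary.Any.Properties using (¬Any[])
open import Data.List.Relation.Unary.AllPairs as AllPairs using (AllPairs; []; _∷_)
import Data.List.Relation.Unary.AllPairs.Properties as AllPairs
open import Data.List.Relation.Unary.Unique.Propositional using (Unique)
open import Data.List.Membership.Propositional using (_∈_)
open import Data.List.Membership.Propositional.Properties using (∈-++⁺ʳ; ∈-++⁻; ∈-map⁺)
open import Data.List.Relation.Binary.Permutation.Propositional
  using (_↭_; ↭-refl; ↭-sym; ↭-trans; ↭-prep; ↭-swap; ↭⇒↭ₛ; module PermutationReasoning)
open import Data.List.Relation.Binary.Permutation.Propositional.Properties
  using (↭-length; ∈-resp-↭; ++⁺ˡ; ++⁺ʳ; shift; drop-mid; filter-↭; map⁺)
import Data.List.Relation.Binary.Permutation.Setoid.Properties as ↭ₛ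
open import Data.Product using (_×_; _,_; proj₁; proj₂; ∃-syntax; <_,_>)
open import Data.Product.Relation.Binary.Lex.Strict using (×-Lex; ×-decidable; ×-asymmetric)
open import Data.Sum as Sum using (_⊎_; inj₁; inj₂; [_,_]′)
open import Data.Unit using (⊤; tt)
open import Data.Bool using (true; false)
open import Function using (_∘_; id; _on_)
open import Relation.Binary.Definitions using (Decidable)
open import Relation.Nullary using (¬_; ¬?; Dec; does; yes; no; contradiction)
open import Relation.Nullary.Decidable using (_×-dec_; dec-true; dec-false)
open import Relation.Binary.PropositionalEquality hiding ([_])

-- Trees

mapTree : {X Y : Set} → (X → Y) → Tree X → Tree Y
mapTree f leaf         = leaf
mapTree f (node l x r) = node (mapTree f l) (f x) (mapTree f r)

module _ {X Y : Set} (f : X → Y) where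

  labels-mapTree : ∀ t → labels (mapTree f t) ≡ map f (labels t)
  labels-mapTree leaf         = refl
  labels-mapTree (node l x r) = begin
    labels (mapTree f l) ++ f x ∷ labels (mapTree f r)
      ≡⟨ cong₂ (λ fl fr → fl ++ f x ∷ fr) (labels-mapTree l) (labels-mapTree r) ⟩
    map f (labels l) ++ map f (x ∷ labels r)
      ≡⟨ map-++ f (labels l) (x ∷ labels r) ⟨
    map f (labels l ++ x ∷ labels r) ∎
    where open ≡-Reasoning

  size-mapTree : ∀ t → size (mapTree f t) ≡ size t
  size-mapTree leaf         = refl
  size-mapTree (node l x r) = cong₂ (λ m n → suc (m + n)) (size-mapTree l) (size-mapTree r)

  AllT-mapTree⁺ : ∀ {P : Y → Set} {t} → AllT (P ∘ f) t → AllT P (mapTree f t)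
  AllT-mapTree⁺ {t = leaf}       _              = tt
  AllT-mapTree⁺ {t = node l x r} (pl , px , pr) = AllT-mapTree⁺ pl , px , AllT-mapTree⁺ pr

  AllT-mapTree⁻ : ∀ {P : Y → Set} {t} → AllT P (mapTree f t) → AllT (P ∘ f) t
  AllT-mapTree⁻ {t = leaf}       _              = tt
  AllT-mapTree⁻ {t = node l x r} (pl , px , pr) = AllT-mapTree⁻ pl , px , AllT-mapTree⁻ pr

module _ {X : Set} {P Q : X → Set} where

  AllT-map : (∀ {x} → P x → Q x) → ∀ {t} → AllT P t → AllT Q t
  AllT-map f {leaf}       _              = tt
  AllT-map f {node l x r} (pl , px , pr) = AllT-map f pl , f px , AllT-map f pr

  AllT-zip : ∀ {t} → AllT P t → AllT Q t → AllT (λ x → P x × Q x) t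
  AllT-zip {leaf}       _              _              = tt
  AllT-zip {node l x r} (pl , px , pr) (ql , qx , qr) = AllT-zip pl ql , (px , qx) , AllT-zip pr qr

AllT⇒All : ∀ {X : Set} {P : X → Set} {t} → AllT P t → All P (labels t)
AllT⇒All {t = leaf}       _              = []
AllT⇒All {t = node l x r} (pl , px , pr) = All.++⁺ (AllT⇒All pl) (px ∷ AllT⇒All pr)

length-labels : ∀ {X : Set} (t : Tree X) → length (labels t) ≡ size t
length-labels leaf         = refl
length-labels (node l x r) = begin
  length (labels l ++ x ∷ labels r)           ≡⟨ length-++ (labels l) ⟩
  length (labels l) + suc (length (labels r)) ≡⟨ +-suc (length (labels l)) _ ⟩
  suc (length (labels l) + length (labels r)) ≡⟨ cong₂ (λ m n → suc (m + n)) (length-labels l) (length-labels r) ⟩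
  suc (size l + size r)                       ∎
  where open ≡-Reasoning

SameShape-unzip : ∀ {X Y : Set} (t : Tree (X × Y)) → SameShape (mapTree proj₁ t) (mapTree proj₂ t)
SameShape-unzip leaf         = leaf
SameShape-unzip (node l _ r) = node (SameShape-unzip l) (SameShape-unzip r)

SameShape⇒zip : ∀ {X Y : Set} {t₁ : Tree X} {t₂ : Tree Y} → SameShape t₁ t₂ →
                ∃[ t ] mapTree proj₁ t ≡ t₁ × mapTree proj₂ t ≡ t₂
SameShape⇒zip leaf = leaf , refl , refl
SameShape⇒zip (node {x = x} {y = y} sl sr) with SameShape⇒zip sl | SameShape⇒zip sr
... | l , refl , refl | r , refl , refl = node l (x , y) r , refl , refl

-- Decreasing trees and 𝒯

IsDecreasing⇒AllT< : ∀ {x} t → IsDecreasing t → RootBelow x t → AllT (_< x) t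
IsDecreasing⇒AllT< leaf         _                     _   = tt
IsDecreasing⇒AllT< (node l y r) (dl , y>l , y>r , dr) y<x =
  AllT-map (λ u<y → <-trans u<y y<x) (IsDecreasing⇒AllT< l dl y>l) , y<x ,
  AllT-map (λ u<y → <-trans u<y y<x) (IsDecreasing⇒AllT< r dr y>r)

maxOf-greatest : ∀ {x y ys} → x ∈ y ∷ ys → All (_≤ x) (y ∷ ys) → maxOf y ys ≡ x
maxOf-greatest {x} {y} {ys} x∈ (y≤x ∷ ys≤x) = ≤-antisym
  (foldr-preservesᵇ ⊔-lub y≤x ys≤x)
  (foldr-preservesᵒ (λ a b → [ m≤n⇒m≤n⊔o b , m≤n⇒m≤o⊔n a ]′) y ys (x≤y⊎x≤ys x∈))
  where
  x≤y⊎x≤ys : x ∈ y ∷ ys → x ≤ y ⊎ Any.Any (x ≤_) ys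
  x≤y⊎x≤ys (here x≡y)   = inj₁ (≤-reflexive x≡y)
  x≤y⊎x≤ys (there x∈ys) = inj₂ (Any.map ≤-reflexive x∈ys)

span-≢ : ∀ {x} A B → All (_≢ x) A → span (λ z → ¬? (z ≟ x)) (A ++ x ∷ B) ≡ (A , x ∷ B)
span-≢ {x} []      B []            rewrite dec-true (x ≟ x) refl = refl
span-≢ {x} (a ∷ A) B (a≢x ∷ A≢x) rewrite dec-false (a ≟ x) a≢x | span-≢ A B A≢x = refl

𝒯-fuel-unfold : ∀ k {x y ys A B} → maxOf y ys ≡ x → span (λ z → ¬? (z ≟ x)) (y ∷ ys) ≡ (A , x ∷ B) →
                𝒯-fuel (suc k) (y ∷ ys) ≡ node (𝒯-fuel k A) x (𝒯-fuel k B)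
𝒯-fuel-unfold k refl split rewrite split = refl

𝒯-fuel-++ : ∀ k {x} A B → All (_< x) A → All (_< x) B →
            𝒯-fuel (suc k) (A ++ x ∷ B) ≡ node (𝒯-fuel k A) x (𝒯-fuel k B)
𝒯-fuel-++ k []      B _   B<x =
  𝒯-fuel-unfold k (maxOf-greatest (here refl) (≤-refl ∷ All.map <⇒≤ B<x)) (span-≢ [] B [])
𝒯-fuel-++ k (a ∷ A) B A<x B<x =
  𝒯-fuel-unfold k
    (maxOf-greatest (∈-++⁺ʳ (a ∷ A) (here refl)) (All.++⁺ (All.map <⇒≤ A<x) (≤-refl ∷ All.map <⇒≤ B<x)))
    (span-≢ (a ∷ A) B (All.map <⇒≢ A<x))

𝒯-fuel-labels : ∀ {k} t → size t ≤ k → IsDecreasing t → 𝒯-fuel k (labels t) ≡ t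
𝒯-fuel-labels {zero}  leaf _ _ = refl
𝒯-fuel-labels {suc k} leaf _ _ = refl
𝒯-fuel-labels {suc k} (node l x r) (s≤s size≤k) (dl , x>l , x>r , dr) = begin
  𝒯-fuel (suc k) (labels l ++ x ∷ labels r)
    ≡⟨ 𝒯-fuel-++ k (labels l) (labels r) (AllT⇒All (IsDecreasing⇒AllT< l dl x>l))
                                         (AllT⇒All (IsDecreasing⇒AllT< r dr x>r)) ⟩
  node (𝒯-fuel k (labels l)) x (𝒯-fuel k (labels r))
    ≡⟨ cong₂ (λ l′ r′ → node l′ x r′) (𝒯-fuel-labels l (≤-trans (m≤m+n (size l) (size r)) size≤k) dl)
                                       (𝒯-fuel-labels r (≤-trans (m≤n+m (size r) (size l)) size≤k) dr) ⟩
  node l x r ∎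
  where open ≡-Reasoning

𝒯-labels : ∀ {t} → IsDecreasing t → 𝒯 (labels t) ≡ t
𝒯-labels {t} = 𝒯-fuel-labels t (≤-reflexive (sym (length-labels t)))

-- Words as lists of (letter, position) pairs

oneTo≡applyUpTo : ∀ n → oneTo n ≡ applyUpTo suc n
oneTo≡applyUpTo zero    = refl
oneTo≡applyUpTo (suc n) = trans (cong (_∷ʳ suc n) (oneTo≡applyUpTo n)) (applyUpTo-∷ʳ suc n)

length-oneTo : ∀ n → length (oneTo n) ≡ n
length-oneTo n = trans (cong length (oneTo≡applyUpTo n)) (length-applyUpTo suc n)

oneTo-increasing : ∀ n → AllPairs _<_ (oneTo n)
oneTo-increasing n =
  subst (AllPairs _<_) (sym (oneTo≡applyUpTo n)) (AllPairs.applyUpTo⁺₁ suc n (λ i<j _ → s<s i<j))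

Unique-oneTo : ∀ n → Unique (oneTo n)
Unique-oneTo n = AllPairs.map <⇒≢ (oneTo-increasing n)

Unique-resp-↭ : ∀ {A : Set} {xs ys : List A} → xs ↭ ys → Unique xs → Unique ys
Unique-resp-↭ {A} p = ↭ₛ.Unique-resp-↭ (setoid A) (↭⇒↭ₛ p)

enumerateWith : (ℕ → ℕ) → Word → List (ℕ × ℕ)
enumerateWith f []       = []
enumerateWith f (x ∷ xs) = (x , f 0) ∷ enumerateWith (f ∘ suc) xs

enumerate : Word → List (ℕ × ℕ)
enumerate = enumerateWith suc

length-enumerateWith : ∀ f w → length (enumerateWith f w) ≡ length w
length-enumerateWith f []       = refl
length-enumerateWith f (x ∷ xs) = cong suc (length-enumerateWith (f ∘ suc) xs)

map-proj₁-enumerateWith : ∀ f w → map proj₁ (enumerateWith f w) ≡ w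
map-proj₁-enumerateWith f []       = refl
map-proj₁-enumerateWith f (x ∷ xs) = cong (x ∷_) (map-proj₁-enumerateWith (f ∘ suc) xs)

map-proj₂-enumerateWith : ∀ f w → map proj₂ (enumerateWith f w) ≡ applyUpTo f (length w)
map-proj₂-enumerateWith f []       = refl
map-proj₂-enumerateWith f (x ∷ xs) = cong (f 0 ∷_) (map-proj₂-enumerateWith (f ∘ suc) xs)

proj₂-∈-enumerateWith : ∀ {f w z} (z∈ : z ∈ enumerateWith f w) → proj₂ z ≡ f (toℕ (index z∈))
proj₂-∈-enumerateWith {w = _ ∷ _} (here refl) = refl
proj₂-∈-enumerateWith {w = _ ∷ _} (there z∈)  = proj₂-∈-enumerateWith z∈

All-enumerateWith : ∀ {P : ℕ → Set} f w → (∀ i → P (f i)) → All (P ∘ proj₂) (enumerateWith f w)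
All-enumerateWith f []       Pf = []
All-enumerateWith f (x ∷ xs) Pf = Pf 0 ∷ All-enumerateWith (f ∘ suc) xs (Pf ∘ suc)

enumerateWith-map-applyUpTo : ∀ f (g : ℕ → ℕ) n →
  enumerateWith f (map g (applyUpTo f n)) ≡ map < g , id > (applyUpTo f n)
enumerateWith-map-applyUpTo f g zero    = refl
enumerateWith-map-applyUpTo f g (suc n) = cong ((g (f 0) , f 0) ∷_) (enumerateWith-map-applyUpTo (f ∘ suc) g n)

map-proj₂-enumerate : ∀ w → map proj₂ (enumerate w) ≡ oneTo (length w)
map-proj₂-enumerate w = trans (map-proj₂-enumerateWith suc w) (sym (oneTo≡applyUpTo (length w)))

enumerate-increasing : ∀ w → AllPairs (_<_ on proj₂) (enumerate w)
enumerate-increasing w =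
  AllPairs.map⁻ (subst (AllPairs _<_) (sym (map-proj₂-enumerate w)) (oneTo-increasing (length w)))

-- Standardization

length-filter-map : ∀ {A B : Set} {P : B → Set} (P? : ∀ y → Dec (P y)) (f : A → B) xs →
                    length (filter P? (map f xs)) ≡ length (filter (P? ∘ f) xs)
length-filter-map P? f []       = refl
length-filter-map P? f (x ∷ xs) with ih ← length-filter-map P? f xs | does (P? (f x))
... | true  = cong suc ih
... | false = ih

length-filter-⊎ : ∀ {A : Set} {P Q : A → Set} (P? : ∀ x → Dec (P x)) (Q? : ∀ x → Dec (Q x))
                  (P⊎Q? : ∀ x → Dec (P x ⊎ Q x)) → (∀ {x} → P x → ¬ Q x) → ∀ xs →
                  length (filter P⊎Q? xs) ≡ length (filter P? xs) + length (filter Q? xs)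
length-filter-⊎ P? Q? P⊎Q? disjoint []       = refl
length-filter-⊎ P? Q? P⊎Q? disjoint (x ∷ xs)
  with ih ← length-filter-⊎ P? Q? P⊎Q? disjoint xs | P? x | Q? x | P⊎Q? x
... | yes p | yes q | _       = contradiction q (disjoint p)
... | yes _ | no _  | yes _   = cong suc ih
... | no _  | yes _ | yes _   = trans (cong suc ih) (sym (+-suc _ _))
... | no _  | no _  | no _    = ih
... | yes p | no _  | no ¬p⊎q = contradiction (inj₁ p) ¬p⊎q
... | no _  | yes q | no ¬p⊎q = contradiction (inj₂ q) ¬p⊎q
... | no ¬p | no ¬q | yes p⊎q = contradiction p⊎q [ ¬p , ¬q ]′

_<ₗₑₓ_ : ℕ × ℕ → ℕ × ℕ → Set
_<ₗₑₓ_ = ×-Lex _≡_ _<_ _<_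

_<ₗₑₓ?_ : Decidable _<ₗₑₓ_
_<ₗₑₓ?_ = ×-decidable _≟_ _<?_ _<?_

<ₗₑₓ-asym : ∀ {y z} → y <ₗₑₓ z → ¬ z <ₗₑₓ y
<ₗₑₓ-asym = ×-asymmetric {_≈₁_ = _≡_} {_<₁_ = _<_} {_<₂_ = _<_} sym (resp₂ _<_) <-asym <-asym

<ₗₑₓ-irrefl : ∀ {z} → ¬ z <ₗₑₓ z
<ₗₑₓ-irrefl z<z = <ₗₑₓ-asym z<z z<z

≤×<⇒<ₗₑₓ : ∀ {y z} → proj₁ y ≤ proj₁ z → proj₂ y < proj₂ z → y <ₗₑₓ z
≤×<⇒<ₗₑₓ y₁≤z₁ y₂<z₂ = Sum.map₂ (_, y₂<z₂) (m≤n⇒m<n∨m≡n y₁≤z₁)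

rank : List (ℕ × ℕ) → ℕ × ℕ → ℕ
rank L z = length (filter (_<ₗₑₓ? z) L)

rank-↭ : ∀ {L L′} → L ↭ L′ → ∀ z → rank L z ≡ rank L′ z
rank-↭ L↭L′ z = ↭-length (filter-↭ (_<ₗₑₓ? z) L↭L′)

rank-increasing : ∀ {Z} → AllPairs _<ₗₑₓ_ Z → map (rank Z) Z ≡ upTo (length Z)
rank-increasing {[]}    []                   = refl
rank-increasing {z ∷ Z} (z<Z ∷ Z-increasing) = cong₂ _∷_ rank-z (begin
  map (rank (z ∷ Z)) Z
    ≡⟨ map-cong-local (All.map (λ {y} z<y → cong length (filter-accept (_<ₗₑₓ? y) z<y)) z<Z) ⟩
  map (suc ∘ rank Z) Z       ≡⟨ map-∘ Z ⟩
  map suc (map (rank Z) Z)   ≡⟨ cong (map suc) (rank-increasing Z-increasing) ⟩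
  map suc (upTo (length Z))  ≡⟨ map-upTo suc (length Z) ⟩
  applyUpTo suc (length Z)   ∎)
  where
  open ≡-Reasoning
  rank-z : rank (z ∷ Z) z ≡ 0
  rank-z = cong length (filter-none (_<ₗₑₓ? z) (<ₗₑₓ-irrefl ∷ All.map <ₗₑₓ-asym z<Z))

countLt-enumerate : ∀ x w → countLt x w ≡ length (filter (λ y → proj₁ y <? x) (enumerate w))
countLt-enumerate x w = begin
  countLt x w                                        ≡⟨ cong (countLt x) (map-proj₁-enumerateWith suc w) ⟨
  length (filter (_<? x) (map proj₁ (enumerate w)))  ≡⟨ length-filter-map (_<? x) proj₁ (enumerate w) ⟩
  length (filter (λ y → proj₁ y <? x) (enumerate w)) ∎
  where open ≡-Reasoning

earlierOccurrence? : (x b : ℕ) (y : ℕ × ℕ) → Dec (proj₁ y ≡ x × proj₂ y < b)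
earlierOccurrence? x b y = (proj₁ y ≟ x) ×-dec (proj₂ y <? b)

countEq-enumerateWith : ∀ {x b} f pre rest →
  (∀ {i} → i < length pre → f i < b) → (∀ i → b ≤ f (length pre + i)) →
  length (filter (earlierOccurrence? x b) (enumerateWith f (pre ++ rest))) ≡ countEq x pre
countEq-enumerateWith {x} {b} f [] rest _ b≤f = cong length (filter-none (earlierOccurrence? x b)
  (All.map (λ b≤y (_ , y<b) → <⇒≱ y<b b≤y) (All-enumerateWith f rest b≤f)))
countEq-enumerateWith {x} {b} f (p ∷ pre) rest f<b b≤f with p ≟ x
... | yes p≡x = begin
  length (filter (earlierOccurrence? x b) ((p , f 0) ∷ enumerateWith (f ∘ suc) (pre ++ rest)))
    ≡⟨ cong length (filter-accept (earlierOccurrence? x b) (p≡x , f<b z<s)) ⟩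
  suc (length (filter (earlierOccurrence? x b) (enumerateWith (f ∘ suc) (pre ++ rest))))
    ≡⟨ cong suc (countEq-enumerateWith (f ∘ suc) pre rest (f<b ∘ s<s) b≤f) ⟩
  suc (countEq x pre)
    ≡⟨ cong length (filter-accept (_≟ x) p≡x) ⟨
  countEq x (p ∷ pre) ∎
  where open ≡-Reasoning
... | no p≢x = begin
  length (filter (earlierOccurrence? x b) ((p , f 0) ∷ enumerateWith (f ∘ suc) (pre ++ rest)))
    ≡⟨ cong length (filter-reject (earlierOccurrence? x b) (p≢x ∘ proj₁)) ⟩
  length (filter (earlierOccurrence? x b) (enumerateWith (f ∘ suc) (pre ++ rest)))
    ≡⟨ countEq-enumerateWith (f ∘ suc) pre rest (f<b ∘ s<s) b≤f ⟩
  countEq x pre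
    ≡⟨ cong length (filter-reject (_≟ x) p≢x) ⟨
  countEq x (p ∷ pre) ∎
  where open ≡-Reasoning

rank-enumerate : ∀ pre x xs →
  countLt x (pre ++ x ∷ xs) + countEq x pre ≡ rank (enumerate (pre ++ x ∷ xs)) (x , suc (length pre))
rank-enumerate pre x xs = sym (begin
  rank L (x , suc (length pre))
    ≡⟨ length-filter-⊎ (λ y → proj₁ y <? x) (earlierOccurrence? x (suc (length pre)))
                       (_<ₗₑₓ? (x , suc (length pre))) (λ { y₁<x (refl , _) → <-irrefl refl y₁<x }) L ⟩
  length (filter (λ y → proj₁ y <? x) L) + length (filter (earlierOccurrence? x (suc (length pre))) L)
    ≡⟨ cong₂ _+_ (sym (countLt-enumerate x w))
                 (countEq-enumerateWith suc pre (x ∷ xs) s<s (λ i → s≤s (m≤m+n (length pre) i))) ⟩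
  countLt x w + countEq x pre ∎)
  where
  open ≡-Reasoning
  w = pre ++ x ∷ xs
  L = enumerate w

stdAux≡map-rank : ∀ {w} f pre xs → pre ++ xs ≡ w → (∀ i → f i ≡ suc (length pre + i)) →
                  stdAux w pre xs ≡ map (suc ∘ rank (enumerate w)) (enumerateWith f xs)
stdAux≡map-rank f pre []       _    _  = refl
stdAux≡map-rank f pre (x ∷ xs) refl f≗ =
  cong₂ _∷_ (cong suc rank-x) (stdAux≡map-rank (f ∘ suc) (pre ∷ʳ x) xs (++-assoc pre [ x ] xs) f∘suc≗)
  where
  rank-x : countLt x (pre ++ x ∷ xs) + countEq x pre ≡ rank (enumerate (pre ++ x ∷ xs)) (x , f 0)
  rank-x = trans (rank-enumerate pre x xs) (cong (λ i → rank (enumerate (pre ++ x ∷ xs)) (x , i))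
                                                 (sym (trans (f≗ 0) (cong suc (+-identityʳ _)))))
  f∘suc≗ : ∀ i → f (suc i) ≡ suc (length (pre ∷ʳ x) + i)
  f∘suc≗ i = trans (f≗ (suc i))
                   (cong suc (trans (sym (+-assoc (length pre) 1 i)) (cong (_+ i) (sym (length-++ pre)))))

std≡map-rank : ∀ w → std w ≡ map (suc ∘ rank (enumerate w)) (enumerate w)
std≡map-rank w = stdAux≡map-rank suc [] w refl (λ _ → refl)

positionOf-here : ∀ k xs → positionOf k (k ∷ xs) ≡ 1
positionOf-here k xs with k ≟ k
... | yes _   = refl
... | no k≢k = contradiction refl k≢k

positionOf-there : ∀ {x k} xs → x ≢ k → positionOf k (x ∷ xs) ≡ suc (positionOf k xs)
positionOf-there {x} {k} xs x≢k with x ≟ k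
... | yes x≡k = contradiction x≡k x≢k
... | no _    = refl

positionOf-map : ∀ {A : Set} {f : A → ℕ} {xs z} → Unique (map f xs) → (z∈ : z ∈ xs) →
                 positionOf (f z) (map f xs) ≡ suc (toℕ (index z∈))
positionOf-map {f = f} (_ ∷ _)    (here refl) = positionOf-here (f _) _
positionOf-map {f = f} (fx∉ ∷ u) (there z∈)  =
  trans (positionOf-there _ (All.lookup fx∉ (∈-map⁺ f z∈))) (cong suc (positionOf-map u z∈))

inverse-std : ∀ w {Z} → AllPairs _<ₗₑₓ_ Z → Z ↭ enumerate w → inverse (std w) ≡ map proj₂ Z
inverse-std w {Z} Z-increasing Z↭L = begin
  inverse (std w)                                ≡⟨ cong inverse std≡σ ⟩
  map (λ k → positionOf k σ) (oneTo (length σ)) ≡⟨ cong (map (λ k → positionOf k σ)) oneTo≡r[Z] ⟩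
  map (λ k → positionOf k σ) (map r Z)           ≡⟨ map-∘ Z ⟨
  map (λ z → positionOf (r z) σ) Z               ≡⟨ map-cong-local (All.tabulate positionOf-r) ⟩
  map proj₂ Z                                    ∎
  where
  open ≡-Reasoning
  L = enumerate w
  r : ℕ × ℕ → ℕ
  r = suc ∘ rank Z
  σ = map r L
  std≡σ : std w ≡ σ
  std≡σ = trans (std≡map-rank w) (map-cong (λ z → cong suc (rank-↭ (↭-sym Z↭L) z)) L)
  r[Z]≡oneTo : map r Z ≡ oneTo (length Z)
  r[Z]≡oneTo = begin
    map (suc ∘ rank Z) Z       ≡⟨ map-∘ Z ⟩
    map suc (map (rank Z) Z)   ≡⟨ cong (map suc) (rank-increasing Z-increasing) ⟩
    map suc (upTo (length Z))  ≡⟨ map-upTo suc (length Z) ⟩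
    applyUpTo suc (length Z)   ≡⟨ oneTo≡applyUpTo (length Z) ⟨
    oneTo (length Z)           ∎
  oneTo≡r[Z] : oneTo (length σ) ≡ map r Z
  oneTo≡r[Z] = trans (cong oneTo (trans (length-map r L) (↭-length (↭-sym Z↭L)))) (sym r[Z]≡oneTo)
  Unique-σ : Unique σ
  Unique-σ = Unique-resp-↭ (map⁺ r Z↭L) (subst Unique (sym r[Z]≡oneTo) (Unique-oneTo (length Z)))
  positionOf-r : ∀ {z} → z ∈ Z → positionOf (r z) σ ≡ proj₂ z
  positionOf-r z∈Z = trans (positionOf-map Unique-σ z∈L) (sym (proj₂-∈-enumerateWith z∈L))
    where z∈L = ∈-resp-↭ Z↭L z∈Z

-- Treaps

insertPair : ℕ × ℕ → Tree (ℕ × ℕ) → Tree (ℕ × ℕ)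
insertPair z leaf = node leaf z leaf
insertPair z (node l y r) with proj₁ y <? proj₁ z
... | yes _ = node l y (insertPair z r)
... | no  _ = node (insertPair z l) y r

bstPairs : List (ℕ × ℕ) → Tree (ℕ × ℕ)
bstPairs = foldr insertPair leaf

IsTreap : Tree (ℕ × ℕ) → Set
IsTreap leaf         = ⊤
IsTreap (node l z r) = IsTreap l × AllT (λ u → proj₁ u ≤ proj₁ z × proj₂ u < proj₂ z) l
                                 × AllT (λ u → proj₁ z < proj₁ u × proj₂ u < proj₂ z) r × IsTreap r

mapTree-proj₁-insertPair : ∀ z t → mapTree proj₁ (insertPair z t) ≡ insert (proj₁ z) (mapTree proj₁ t)
mapTree-proj₁-insertPair z leaf = refl
mapTree-proj₁-insertPair z (node l y r) with proj₁ y <? proj₁ z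
... | yes _ = cong (node _ (proj₁ y)) (mapTree-proj₁-insertPair z r)
... | no  _ = cong (λ l′ → node l′ (proj₁ y) _) (mapTree-proj₁-insertPair z l)

mapTree-proj₁-bstPairs : ∀ L → mapTree proj₁ (bstPairs L) ≡ bst (map proj₁ L)
mapTree-proj₁-bstPairs []      = refl
mapTree-proj₁-bstPairs (z ∷ L) =
  trans (mapTree-proj₁-insertPair z (bstPairs L)) (cong (insert (proj₁ z)) (mapTree-proj₁-bstPairs L))

labels-insertPair : ∀ z t → labels (insertPair z t) ↭ z ∷ labels t
labels-insertPair z leaf = ↭-refl
labels-insertPair z (node l y r) with proj₁ y <? proj₁ z
... | yes _ =
  ↭-trans (++⁺ˡ (labels l) (↭-prep y (labels-insertPair z r)))
          (↭-trans (++⁺ˡ (labels l) (↭-swap y z ↭-refl)) (shift z (labels l) (y ∷ labels r)))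
... | no  _ = ++⁺ʳ (y ∷ labels r) (labels-insertPair z l)

labels-bstPairs : ∀ L → labels (bstPairs L) ↭ L
labels-bstPairs []      = ↭-refl
labels-bstPairs (z ∷ L) = ↭-trans (labels-insertPair z (bstPairs L)) (↭-prep z (labels-bstPairs L))

AllT-insertPair : ∀ {P : ℕ × ℕ → Set} {z} t → P z → AllT P t → AllT P (insertPair z t)
AllT-insertPair leaf pz _ = tt , pz , tt
AllT-insertPair {z = z} (node l y r) pz (pl , py , pr) with proj₁ y <? proj₁ z
... | yes _ = pl , py , AllT-insertPair r pz pr
... | no  _ = AllT-insertPair l pz pl , py , pr

AllT-bstPairs : ∀ {P : ℕ × ℕ → Set} {L} → All P L → AllT P (bstPairs L)
AllT-bstPairs []        = tt
AllT-bstPairs (pz ∷ pL) = AllT-insertPair _ pz (AllT-bstPairs pL)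

IsTreap-insertPair : ∀ {z} t → AllT (λ u → proj₂ z < proj₂ u) t → IsTreap t → IsTreap (insertPair z t)
IsTreap-insertPair leaf _ _ = tt , tt , tt , tt
IsTreap-insertPair {z} (node l y r) (z<l , z<y , z<r) (tl , l<y , y<r , tr) with proj₁ y <? proj₁ z
... | yes y₁<z₁ = tl , l<y , AllT-insertPair r (y₁<z₁ , z<y) y<r , IsTreap-insertPair r z<r tr
... | no  y₁≮z₁ = IsTreap-insertPair l z<l tl , AllT-insertPair l (≮⇒≥ y₁≮z₁ , z<y) l<y , y<r , tr

IsTreap-bstPairs : ∀ {L} → AllPairs (_<_ on proj₂) L → IsTreap (bstPairs L)
IsTreap-bstPairs []                   = tt
IsTreap-bstPairs (z<L ∷ L-increasing) =
  IsTreap-insertPair _ (AllT-bstPairs z<L) (IsTreap-bstPairs L-increasing)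

IsTreap⇒IsBST : ∀ {t} → IsTreap t → IsBST (mapTree proj₁ t)
IsTreap⇒IsBST {leaf}       _                    = tt
IsTreap⇒IsBST {node l z r} (tl , l<z , z<r , tr) =
  IsTreap⇒IsBST tl , AllT-mapTree⁺ proj₁ (AllT-map proj₁ l<z) ,
  AllT-mapTree⁺ proj₁ (AllT-map proj₁ z<r) , IsTreap⇒IsBST tr

IsTreap⇒IsDecreasing : ∀ {t} → IsTreap t → IsDecreasing (mapTree proj₂ t)
IsTreap⇒IsDecreasing {leaf}       _                    = tt
IsTreap⇒IsDecreasing {node l z r} (tl , l<z , z<r , tr) =
  IsTreap⇒IsDecreasing tl , rootBelow l l<z , rootBelow r z<r , IsTreap⇒IsDecreasing tr
  where
  rootBelow : ∀ {Q : ℕ × ℕ → Set} t → AllT (λ u → Q u × proj₂ u < proj₂ z) t →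
              RootBelow (proj₂ z) (mapTree proj₂ t)
  rootBelow leaf         _                   = tt
  rootBelow (node _ _ _) (_ , (_ , u<z) , _) = u<z

IsBST×IsDecreasing⇒IsTreap : ∀ t → IsBST (mapTree proj₁ t) → IsDecreasing (mapTree proj₂ t) → IsTreap t
IsBST×IsDecreasing⇒IsTreap leaf _ _ = tt
IsBST×IsDecreasing⇒IsTreap (node l z r) (bl , l≤z , z<r , br) (dl , z>l , z>r , dr) =
  IsBST×IsDecreasing⇒IsTreap l bl dl ,
  AllT-zip (AllT-mapTree⁻ proj₁ l≤z) (AllT-mapTree⁻ proj₂ (IsDecreasing⇒AllT< (mapTree proj₂ l) dl z>l)) ,
  AllT-zip (AllT-mapTree⁻ proj₁ z<r) (AllT-mapTree⁻ proj₂ (IsDecreasing⇒AllT< (mapTree proj₂ r) dr z>r)) ,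
  IsBST×IsDecreasing⇒IsTreap r br dr

IsTreap⇒increasing : ∀ {t} → IsTreap t → AllPairs _<ₗₑₓ_ (labels t)
IsTreap⇒increasing {leaf}       _                    = []
IsTreap⇒increasing {node l z r} (tl , l<z , z<r , tr) =
  AllPairs.++⁺ (IsTreap⇒increasing tl) (All.map (inj₁ ∘ proj₁) z<R ∷ IsTreap⇒increasing tr)
    (All.map (λ (u₁≤z₁ , u₂<z₂) → ≤×<⇒<ₗₑₓ u₁≤z₁ u₂<z₂ ∷ All.map (inj₁ ∘ ≤-<-trans u₁≤z₁ ∘ proj₁) z<R) L<z)
  where
  L<z = AllT⇒All l<z
  z<R = AllT⇒All z<r

IsTreap⇒root-maximal : ∀ {l z r u} → IsTreap (node l z r) → u ∈ labels (node l z r) →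
                       u ≡ z ⊎ proj₂ u < proj₂ z
IsTreap⇒root-maximal {l} (_ , l<z , z<r , _) u∈ with ∈-++⁻ (labels l) u∈
... | inj₁ u∈l         = inj₂ (proj₂ (All.lookup (AllT⇒All l<z) u∈l))
... | inj₂ (here u≡z)  = inj₁ u≡z
... | inj₂ (there u∈r) = inj₂ (proj₂ (All.lookup (AllT⇒All z<r) u∈r))

root-unique : ∀ {l z r l′ z′ r′} → IsTreap (node l z r) → IsTreap (node l′ z′ r′) →
              labels (node l z r) ↭ labels (node l′ z′ r′) → z ≡ z′
root-unique {l} {l′ = l′} t t′ t↭t′
  with IsTreap⇒root-maximal t′ (∈-resp-↭ t↭t′ (∈-++⁺ʳ (labels l) (here refl)))
     | IsTreap⇒root-maximal t (∈-resp-↭ (↭-sym t↭t′) (∈-++⁺ʳ (labels l′) (here refl)))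
... | inj₁ z≡z′ | _          = z≡z′
... | inj₂ _    | inj₁ z′≡z  = sym z′≡z
... | inj₂ z<z′ | inj₂ z′<z  = contradiction z′<z (<-asym z<z′)

filter-children : ∀ {l z r} → IsTreap (node l z r) →
  filter (λ u → proj₁ u ≤? proj₁ z) (labels l ++ labels r) ≡ labels l ×
  filter (λ u → proj₁ z <? proj₁ u) (labels l ++ labels r) ≡ labels r
filter-children {l} {z} {r} (_ , l<z , z<r , _) =
  trans (filter-++ ≤z? (labels l) (labels r))
        (trans (cong₂ _++_ (filter-all ≤z? (All.map proj₁ L<z)) (filter-none ≤z? (All.map (<⇒≱ ∘ proj₁) z<R)))
               (++-identityʳ (labels l))) ,
  trans (filter-++ z<? (labels l) (labels r))
        (cong₂ _++_ (filter-none z<? (All.map (≤⇒≯ ∘ proj₁) L<z)) (filter-all z<? (All.map proj₁ z<R)))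
  where
  ≤z? = λ (u : ℕ × ℕ) → proj₁ u ≤? proj₁ z
  z<? = λ (u : ℕ × ℕ) → proj₁ z <? proj₁ u
  L<z = AllT⇒All l<z
  z<R = AllT⇒All z<r

treap-unique : ∀ {t t′} → IsTreap t → IsTreap t′ → labels t ↭ labels t′ → t ≡ t′
treap-unique {leaf}       {leaf}       _ _ _     = refl
treap-unique {leaf}       {node l _ _} _ _ []↭t′ =
  contradiction (∈-resp-↭ (↭-sym []↭t′) (∈-++⁺ʳ (labels l) (here refl))) ¬Any[]
treap-unique {node l _ _} {leaf}       _ _ t↭[]  =
  contradiction (∈-resp-↭ t↭[] (∈-++⁺ʳ (labels l) (here refl))) ¬Any[]
treap-unique {node l z r} {node l′ z′ r′} t@(tl , _ , _ , tr) t′@(tl′ , _ , _ , tr′) t↭t′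
  with root-unique t t′ t↭t′
... | refl = cong₂ (λ l″ r″ → node l″ z r″) (treap-unique tl tl′ l↭l′) (treap-unique tr tr′ r↭r′)
  where
  children↭ : labels l ++ labels r ↭ labels l′ ++ labels r′
  children↭ = drop-mid (labels l) (labels l′) t↭t′
  l↭l′ : labels l ↭ labels l′
  l↭l′ = subst₂ _↭_ (proj₁ (filter-children t)) (proj₁ (filter-children t′)) (filter-↭ _ children↭)
  r↭r′ : labels r ↭ labels r′
  r↭r′ = subst₂ _↭_ (proj₂ (filter-children t)) (proj₂ (filter-children t′)) (filter-↭ _ children↭)

-- Reading a word off its (letter, position) pairs

lookupLabel-here : ∀ a b ps → lookupLabel b ((a , b) ∷ ps) ≡ a
lookupLabel-here a b ps with b ≟ b
... | yes _   = refl
... | no b≢b = contradiction refl b≢b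

lookupLabel-there : ∀ {a b i} ps → b ≢ i → lookupLabel i ((a , b) ∷ ps) ≡ lookupLabel i ps
lookupLabel-there {b = b} {i} ps b≢i with b ≟ i
... | yes b≡i = contradiction b≡i b≢i
... | no _    = refl

lookupLabel-∈ : ∀ {Z z} → Unique (map proj₂ Z) → z ∈ Z → lookupLabel (proj₂ z) Z ≡ proj₁ z
lookupLabel-∈ {(a , b) ∷ ps} _ (here refl) = lookupLabel-here a b ps
lookupLabel-∈ (z∉ ∷ u) (there z∈) =
  trans (lookupLabel-there _ (All.lookup z∉ (∈-map⁺ proj₂ z∈))) (lookupLabel-∈ u z∈)

wordOf : List (ℕ × ℕ) → Word
wordOf Z = map (λ i → lookupLabel i Z) (oneTo (length Z))

length-wordOf : ∀ Z → length (wordOf Z) ≡ length Z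
length-wordOf Z = trans (length-map _ (oneTo (length Z))) (length-oneTo (length Z))

wordOf-enumerate : ∀ {w Z} → Z ↭ enumerate w → wordOf Z ≡ w
wordOf-enumerate {w} {Z} Z↭L = begin
  map (λ i → lookupLabel i Z) (oneTo (length Z)) ≡⟨ cong (map (λ i → lookupLabel i Z)) oneTo≡positions ⟩
  map (λ i → lookupLabel i Z) (map proj₂ L)      ≡⟨ map-∘ L ⟨
  map (λ z → lookupLabel (proj₂ z) Z) L          ≡⟨ map-cong-local (All.tabulate lookupLabel-∈L) ⟩
  map proj₁ L                                    ≡⟨ map-proj₁-enumerateWith suc w ⟩
  w                                              ∎
  where
  open ≡-Reasoning
  L = enumerate w
  oneTo≡positions : oneTo (length Z) ≡ map proj₂ L
  oneTo≡positions = trans (cong oneTo (trans (↭-length Z↭L) (length-enumerateWith suc w)))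
                          (sym (map-proj₂-enumerate w))
  Unique-Z : Unique (map proj₂ Z)
  Unique-Z = Unique-resp-↭ (map⁺ proj₂ (↭-sym Z↭L))
                           (subst Unique (sym (map-proj₂-enumerate w)) (Unique-oneTo (length w)))
  lookupLabel-∈L : ∀ {z} → z ∈ L → lookupLabel (proj₂ z) Z ≡ proj₁ z
  lookupLabel-∈L = lookupLabel-∈ Unique-Z ∘ ∈-resp-↭ (↭-sym Z↭L)

enumerate-wordOf : ∀ {Z} → map proj₂ Z ↭ oneTo (length Z) → enumerate (wordOf Z) ↭ Z
enumerate-wordOf {Z} positions = begin
  enumerate (map g (oneTo n))                  ≡⟨ cong (enumerate ∘ map g) (oneTo≡applyUpTo n) ⟩
  enumerate (map g (applyUpTo suc n))          ≡⟨ enumerateWith-map-applyUpTo suc g n ⟩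
  map < g , id > (applyUpTo suc n)             ≡⟨ cong (map < g , id >) (oneTo≡applyUpTo n) ⟨
  map < g , id > (oneTo n)                     ↭⟨ map⁺ < g , id > (↭-sym positions) ⟩
  map < g , id > (map proj₂ Z)                 ≡⟨ map-∘ Z ⟨
  map (λ z → (g (proj₂ z) , proj₂ z)) Z        ≡⟨ map-id-local (All.tabulate (cong (_, _) ∘ lookupLabel-∈ Unique-Z)) ⟩
  Z                                            ∎
  where
  open PermutationReasoning
  n = length Z
  g = λ i → lookupLabel i Z
  Unique-Z : Unique (map proj₂ Z)
  Unique-Z = Unique-resp-↭ (↭-sym positions) (Unique-oneTo n)

zip-proj₁-proj₂ : ∀ {A B : Set} (Z : List (A × B)) → zip (map proj₁ Z) (map proj₂ Z) ≡ Z
zip-proj₁-proj₂ []      = refl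
zip-proj₁-proj₂ (z ∷ Z) = cong (z ∷_) (zip-proj₁-proj₂ Z)

SSB-unzip : ∀ t → SSB (mapTree proj₁ t) (mapTree proj₂ t) ≡ wordOf (labels t)
SSB-unzip t = cong₂ (λ Z n → map (λ i → lookupLabel i Z) (oneTo n))
  (trans (cong₂ zip (labels-mapTree proj₁ t) (labels-mapTree proj₂ t)) (zip-proj₁-proj₂ (labels t)))
  (trans (size-mapTree proj₂ t) (sym (length-labels t)))

-- SSA and SSB

treap : Word → Tree (ℕ × ℕ)
treap w = bstPairs (enumerate w)

IsTreap-treap : ∀ w → IsTreap (treap w)
IsTreap-treap w = IsTreap-bstPairs (enumerate-increasing w)

labels-treap : ∀ w → labels (treap w) ↭ enumerate w
labels-treap w = labels-bstPairs (enumerate w)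

bst≡mapTree-proj₁-treap : ∀ w → bst w ≡ mapTree proj₁ (treap w)
bst≡mapTree-proj₁-treap w =
  trans (cong bst (sym (map-proj₁-enumerateWith suc w))) (sym (mapTree-proj₁-bstPairs (enumerate w)))

𝒯-inverse-std≡mapTree-proj₂-treap : ∀ w → 𝒯 (inverse (std w)) ≡ mapTree proj₂ (treap w)
𝒯-inverse-std≡mapTree-proj₂-treap w = begin
  𝒯 (inverse (std w))          ≡⟨ cong 𝒯 (inverse-std w (IsTreap⇒increasing (IsTreap-treap w)) (labels-treap w)) ⟩
  𝒯 (map proj₂ (labels t))     ≡⟨ cong 𝒯 (labels-mapTree proj₂ t) ⟨
  𝒯 (labels (mapTree proj₂ t)) ≡⟨ 𝒯-labels (IsTreap⇒IsDecreasing (IsTreap-treap w)) ⟩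
  mapTree proj₂ t              ∎
  where
  open ≡-Reasoning
  t = treap w

SSA≡unzip-treap : ∀ w → SSA w ≡ (mapTree proj₁ (treap w) , mapTree proj₂ (treap w))
SSA≡unzip-treap w = cong₂ _,_ (bst≡mapTree-proj₁-treap w) (𝒯-inverse-std≡mapTree-proj₂-treap w)

SSA-correct : ∀ n w → length w ≡ n →
  IsBST (bst w) × size (bst w) ≡ n × IsStdDecreasing (𝒯 (inverse (std w))) ×
  SameShape (bst w) (𝒯 (inverse (std w))) × SSB (bst w) (𝒯 (inverse (std w))) ≡ w
SSA-correct _ w refl rewrite bst≡mapTree-proj₁-treap w | 𝒯-inverse-std≡mapTree-proj₂-treap w =
  IsTreap⇒IsBST (IsTreap-treap w) ,
  trans (size-mapTree proj₁ t) size-t ,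
  (IsTreap⇒IsDecreasing (IsTreap-treap w) , standard) ,
  SameShape-unzip t ,
  trans (SSB-unzip t) (wordOf-enumerate (labels-treap w))
  where
  t = treap w
  size-t : size t ≡ length w
  size-t = trans (sym (length-labels t)) (trans (↭-length (labels-treap w)) (length-enumerateWith suc w))
  standard : labels (mapTree proj₂ t) ↭ oneTo (size (mapTree proj₂ t))
  standard = subst₂ _↭_ (sym (labels-mapTree proj₂ t))
                        (trans (map-proj₂-enumerate w) (cong oneTo (sym (trans (size-mapTree proj₂ t) size-t))))
                        (map⁺ proj₂ (labels-treap w))

SSB-correct : ∀ n t₁ t₂ → IsBST t₁ → size t₁ ≡ n → IsStdDecreasing t₂ → SameShape t₁ t₂ →
              length (SSB t₁ t₂) ≡ n × SSA (SSB t₁ t₂) ≡ (t₁ , t₂)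
SSB-correct _ _ _ bst₁ refl (decreasing₂ , standard₂) shape with SameShape⇒zip shape
... | t , refl , refl =
  length-w , trans (SSA≡unzip-treap w) (cong (λ t′ → mapTree proj₁ t′ , mapTree proj₂ t′) treap-w≡t)
  where
  Z = labels t
  w = SSB (mapTree proj₁ t) (mapTree proj₂ t)
  size≡length : ∀ f → size (mapTree f t) ≡ length Z
  size≡length f = trans (size-mapTree f t) (sym (length-labels t))
  length-w : length w ≡ size (mapTree proj₁ t)
  length-w = trans (cong length (SSB-unzip t)) (trans (length-wordOf Z) (sym (size≡length proj₁)))
  positions : map proj₂ Z ↭ oneTo (length Z)
  positions = subst₂ _↭_ (labels-mapTree proj₂ t) (cong oneTo (size≡length proj₂)) standard₂
  treap-w≡t : treap w ≡ t
  treap-w≡t = treap-unique (IsTreap-treap w) (IsBST×IsDecreasing⇒IsTreap t bst₁ decreasing₂)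
    (↭-trans (labels-treap w) (subst (λ v → enumerate v ↭ Z) (sym (SSB-unzip t)) (enumerate-wordOf positions)))

mainTheorem3 : (n : ℕ) →
    ((w : Word) → length w ≡ n →
      IsBST (bst w) × size (bst w) ≡ n ×
      IsStdDecreasing (𝒯 (inverse (std w))) ×
      SameShape (bst w) (𝒯 (inverse (std w))) ×
      SSB (bst w) (𝒯 (inverse (std w))) ≡ w)
    ×
    ((t₁ t₂ : Tree ℕ) → IsBST t₁ → size t₁ ≡ n →
      IsStdDecreasing t₂ → SameShape t₁ t₂ →
      length (SSB t₁ t₂) ≡ n × SSA (SSB t₁ t₂) ≡ (t₁ , t₂))
mainTheorem3 n = SSA-correct n , SSB-correct n
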